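{- Let $\dot G\in\mathcal C_1\cup\mathcal C_4\cup\mathcal C_5$ be a connected, non-complete, $6$-regular and $2$ net-regular strongly regular signed graph. If $\dot G$ has parameters $(9,6,-1,0,1)$, then $\dot G$ is isomorphic to $\dot S^1_9$. Here $\dot S^1_9$ is the signed graph on vertex set $\mathbb Z_9$ in which distinct $x,y$ are adjacent iff $x-y\notin\{\pm1\}$. The edge $xy$ is negative if $x-y\in\{\pm2\}$ and positive if $x-y\in\{\pm3,\pm4\}$.
   Context: Signed graphs. - A signed graph $\dot G=(G,\sigma)$ is a simple graph $G$ (the underlying graph) with a sign function $\sigma:E(G)\to\{\pm1\}$. - The adjacency matrix has entries $\sigma(v_iv_j)$ for adjacent pairs and $0$ otherwise. - Connected, complete and regular refer to $G$. - $\dot G$ is $\rho$ net-regular if every vertex has (number of positive incident edges) $-$ (number of negative incident edges) $=\rho$. - $\dot G$ is homogeneous if all edges have the same sign. - Isomorphism of signed graphs means a graph isomorphism preserving signs. Strongly regular signed graphs. - An SRSG is a signed graph on $n$ vertices, neither homogeneous complete nor edgeless, for which there are $r\in\mathbb N$ and $a,b,c\in\mathbb Z$ such that the entries of $A(\dot G)^2$ are: - $r$ on the diagonal; - $a$ for pairs joined by a positive edge; - $b$ for pairs joined by a negative edge; - $c$ for distinct non-adjacent pairs. - $(n,r,a,b,c)$ are its parameters. Classes of inhomogeneous SRSGs. - $\mathcal C_1$: $a=-b$, and either complete, or non-complete with $c\ne0$. - $\mathcal C_4$: $a\ne-b$, non-complete, $c=0$. - $\mathcal C_5$: $a\ne-b$,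 non-complete, $c\ne\frac{a+b}2$ and $c\neq0$. -}

module Defs where

open import Data.Nat using (ℕ; zero; suc; _∸_; _%_)
import Data.Nat as ℕ
open import Data.Integer using (ℤ; +_; -_; _-_) renaming (_+_ to _+ℤ_; _*_ to _*ℤ_)
open import Data.Fin using (Fin; toℕ) renaming (zero to fz; suc to fs)
open import Data.Sum using (_⊎_)
open import Data.Product using (_×_; Σ)
open import Relation.Nullary using (¬_)
open import Relation.Binary.PropositionalEquality using (_≡_; _≢_)
open import Function.Bundles using (_↔_; Inverse)
open import Data.Fin.Properties using (all?)
open import Relation.Nullary using (Dec; yes; no)
open import Relation.Nullary.Decidable using (toWitness)
open import Relation.Binary.PropositionalEquality using (refl)

data Edge : Set where
  none pos neg : Edge

record SignedGraph (n : ℕ) : Set where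
  field
    adj   : Fin n → Fin n → Edge
    sym   : ∀ i j → adj i j ≡ adj j i
    loopless : ∀ i → adj i i ≡ none
open SignedGraph public

Σℤ : ∀ {n} → (Fin n → ℤ) → ℤ
Σℤ {zero} f = + 0
Σℤ {suc n} f = f fz +ℤ Σℤ (λ k → f (fs k))

Σℕ : ∀ {n} → (Fin n → ℕ) → ℕ
Σℕ {zero} f = 0
Σℕ {suc n} f = f fz ℕ.+ Σℕ (λ k → f (fs k))

edgeValue : Edge → ℤ
edgeValue none = + 0
edgeValue pos = + 1
edgeValue neg = - (+ 1)

A : ∀ {n} → SignedGraph n → Fin n → Fin n → ℤ
A G i j = edgeValue (adj G i j)

A² : ∀ {n} → SignedGraph n → Fin n → Fin n → ℤ
A² G i j = Σℤ (λ k → A G i k *ℤ A G k j)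

isPos isNeg isEdge : Edge → ℕ
isPos pos = 1
isPos _ = 0
isNeg neg = 1
isNeg _ = 0
isEdge none = 0
isEdge _ = 1

degree posDegree negDegree : ∀ {n} → SignedGraph n → Fin n → ℕ
degree G i = Σℕ (λ k → isEdge (adj G i k))
posDegree G i = Σℕ (λ k → isPos (adj G i k))
negDegree G i = Σℕ (λ k → isNeg (adj G i k))

Regular : ∀ {n} → SignedGraph n → ℕ → Set
Regular G r = ∀ i → degree G i ≡ r

NetRegular : ∀ {n} → SignedGraph n → ℤ → Set
NetRegular G ρ = ∀ i → (+ posDegree G i) - (+ negDegree G i) ≡ ρ

Complete : ∀ {n} → SignedGraph n → Set
Complete G = ∀ i j → i ≢ j → adj G i j ≢ none

Edgeless : ∀ {n} → SignedGraph n → Set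
Edgeless G = ∀ i j → adj G i j ≡ none

Homogeneous : ∀ {n} → SignedGraph n → Set
Homogeneous G = (∀ i j → adj G i j ≢ neg) ⊎ (∀ i j → adj G i j ≢ pos)

data Reach {n} (G : SignedGraph n) : Fin n → Fin n → Set where
  here : ∀ {i} → Reach G i i
  step : ∀ {i k j} → adj G i k ≢ none → Reach G k j → Reach G i j

Connected : ∀ {n} → SignedGraph n → Set
Connected G = ∀ i j → Reach G i j

IsSRSG : ∀ {n} → SignedGraph n → ℕ → ℤ → ℤ → ℤ → Set
IsSRSG {n} G r a b c =
  ¬ (Homogeneous G × Complete G) × ¬ Edgeless G ×
  (∀ i → A² G i i ≡ + r) ×
  (∀ i j → adj G i j ≡ pos → A² G i j ≡ a) ×
  (∀ i j → adj G i j ≡ neg → A² G i j ≡ b) ×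
  (∀ i j → i ≢ j → adj G i j ≡ none → A² G i j ≡ c)

InC1 InC4 InC5 : ∀ {n} → SignedGraph n → ℤ → ℤ → ℤ → Set
InC1 G a b c = ¬ Homogeneous G × a ≡ - b × (Complete G ⊎ (¬ Complete G × c ≢ + 0))
InC4 G a b c = ¬ Homogeneous G × a ≢ - b × ¬ Complete G × c ≡ + 0
-- c ≠ (a+b)/2 written as 2c ≠ a+b
InC5 G a b c = ¬ Homogeneous G × a ≢ - b × ¬ Complete G ×
               (+ 2) *ℤ c ≢ a +ℤ b × c ≢ + 0

_≅_ : ∀ {n} → SignedGraph n → SignedGraph n → Set
_≅_ {n} G H = Σ (Fin n ↔ Fin n) λ π →
  ∀ i j → adj H (Inverse.to π i) (Inverse.to π j) ≡ adj G i j

s9label : ℕ → Edge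
s9label 2 = neg
s9label 7 = neg
s9label 3 = pos
s9label 4 = pos
s9label 5 = pos
s9label 6 = pos
s9label _ = none

s9adj : Fin 9 → Fin 9 → Edge
s9adj x y = s9label ((9 ℕ.+ toℕ x ∸ toℕ y) % 9)

_≟E_ : (e f : Edge) → Dec (e ≡ f)
none ≟E none = yes refl
pos ≟E pos = yes refl
neg ≟E neg = yes refl
none ≟E pos = no λ ()
none ≟E neg = no λ ()
pos ≟E none = no λ ()
pos ≟E neg = no λ ()
neg ≟E none = no λ ()
neg ≟E pos = no λ ()

s9sym : ∀ x y → s9adj x y ≡ s9adj y x
s9sym = toWitness {a? = all? λ x → all? λ y → s9adj x y ≟E s9adj y x} _

s9loop : ∀ x → s9adj x x ≡ none
s9loop = toWitness {a? = all? λ x → s9adj x x ≟E none} _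

S¹₉ : SignedGraph 9
S¹₉ = record { adj = s9adj ; sym = s9sym ; loopless = s9loop }

-- For i ≢ j, A² i j differs from the number of common neighbours of i and j by an even
-- number, and in a 6-regular graph on 9 vertices that number is 3 + Z i j, where Z i j counts
-- the vertices adjacent to neither i nor j (a vertex is not adjacent to itself). The prescribed
-- entries of A² therefore say that Z i j is odd exactly when ij is a negative edge.
--
-- Every vertex has exactly two non-neighbours, so non-adjacency is a 2-regular graph.
-- Computing Z from these non-neighbourhoods, the parity rule excludes triangles and, using a
-- negative neighbour provided by net-regularity, 4-cycles. A 2-regular graph of girth at least
-- 5 on 9 vertices is a single 9-cycle, as two cycles would need 10 vertices. Numbering the
-- vertices along it, G and S¹₉ have the same non-edges, hence the same counts Z, and since S¹₉
-- obeys the same parity rule, also the same signs.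

module Submission where

open import Defs hiding (sym)
open import Data.Bool using (if_then_else_)
open import Data.Empty using (⊥; ⊥-elim)
open import Data.Fin using (Fin; toℕ; punchIn; fromℕ<; splitAt; join) renaming (zero to fz; suc to fs)
open import Data.Fin.Properties
  using (_≟_; suc-injective; toℕ<n; toℕ-injective; toℕ-fromℕ<; punchInᵢ≢i; punchIn-injective;
         punchIn-punchOut; join-splitAt; injective⇒≤; ¬∀⟶∃¬; any?; all?)
open import Data.Integer using (ℤ; +_; -_; _-_) renaming (_+_ to _+ℤ_; _*_ to _*ℤ_)
import Data.Integer.Properties as ℤ
open import Data.Nat using (ℕ; zero; suc; _+_; _*_; _%_; _≤_; _<_; _<?_; z≤n; s≤s; s≤s⁻¹)
  renaming (_≟_ to _≟ℕ_)
open import Data.Nat.DivMod using (_mod_; [m+kn]%n≡m%n; m≤n⇒m%n≡m)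
open import Data.Nat.Properties
  using (+-*-semiring; +-identityʳ; *-identityˡ; *-distribʳ-+; *-comm; +-assoc; +-comm;
         +-cancelˡ-≡; +-cancelʳ-≡; +-monoˡ-≤; <-cmp; <-irrefl; <-trans; ≤-refl; ≤-trans; ≤-antisym;
         n<1+n; m≤n⇒m<n∨m≡n; <⇒≤; <⇒≱; ≮⇒≥)
import Data.Nat.Properties as ℕ
open import Data.Product using (∃; _×_; _,_; proj₁; proj₂)
open import Data.Sum using (_⊎_; inj₁; inj₂; [_,_]′)
open import Data.Vec.Functional using (_∷_)
open import Function using (_∘_; case_of_)
open import Function.Bundles using (mk↔ₛ′)
open import Relation.Binary.Definitions using (tri<; tri≈; tri>)
open import Relation.Binary.PropositionalEquality
open import Relation.Nullary using (¬_; Dec; yes; no; does)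
open import Relation.Nullary.Decidable using (dec-true; dec-false; toWitness; ¬?; _→-dec_)
open import Algebra.Properties.CommutativeSemigroup ℤ.+-commutativeSemigroup using (interchange; xy∙z≈xz∙y)
open import Algebra.Properties.Semiring.Sum +-*-semiring
  using (sum; sum-cong-≗; ∑-distrib-+; sum-remove; sum-replicate-zero; *-distribˡ-sum)

open ≡-Reasoning

Σℕ≡sum : ∀ {n} (f : Fin n → ℕ) → Σℕ f ≡ sum f
Σℕ≡sum {zero}  f = refl
Σℕ≡sum {suc n} f = cong (_+_ (f fz)) (Σℕ≡sum (f ∘ fs))

Σℕ-cong : ∀ {n} {f g : Fin n → ℕ} → (∀ k → f k ≡ g k) → Σℕ f ≡ Σℕ g
Σℕ-cong {f = f} {g} f≗g = trans (Σℕ≡sum f) (trans (sum-cong-≗ f≗g) (sym (Σℕ≡sum g)))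

Σℕ-+ : ∀ {n} (f g : Fin n → ℕ) → Σℕ (λ k → f k + g k) ≡ Σℕ f + Σℕ g
Σℕ-+ f g = begin
  Σℕ (λ k → f k + g k)  ≡⟨ Σℕ≡sum (λ k → f k + g k) ⟩
  sum (λ k → f k + g k) ≡⟨ ∑-distrib-+ f g ⟩
  sum f + sum g         ≡⟨ cong₂ _+_ (Σℕ≡sum f) (Σℕ≡sum g) ⟨
  Σℕ f + Σℕ g           ∎

Σℕ-zero : ∀ {n} {f : Fin n → ℕ} → (∀ k → f k ≡ 0) → Σℕ f ≡ 0
Σℕ-zero {n} {f} f≗0 = begin
  Σℕ f              ≡⟨ Σℕ-cong f≗0 ⟩
  Σℕ {n} (λ _ → 0)  ≡⟨ Σℕ≡sum {n} (λ _ → 0) ⟩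
  sum {n} (λ _ → 0) ≡⟨ sum-replicate-zero n ⟩
  0                 ∎

Σℕ-nonzero : ∀ {n} {f : Fin n → ℕ} → Σℕ f ≢ 0 → ∃ λ k → f k ≢ 0
Σℕ-nonzero {n} {f} Σf≢0 = ¬∀⟶∃¬ n (λ k → f k ≡ 0) (λ k → f k ≟ℕ 0) (Σf≢0 ∘ Σℕ-zero)

Σℕ-ones : ∀ {n} → Σℕ {n} (λ _ → 1) ≡ n
Σℕ-ones {zero}  = refl
Σℕ-ones {suc n} = cong suc Σℕ-ones

Σℕ-remove : ∀ {n} (i : Fin (suc n)) (f : Fin (suc n) → ℕ) → Σℕ f ≡ f i + Σℕ (f ∘ punchIn i)
Σℕ-remove i f = begin
  Σℕ f                      ≡⟨ Σℕ≡sum f ⟩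
  sum f                     ≡⟨ sum-remove {i = i} f ⟩
  f i + sum (f ∘ punchIn i) ≡⟨ cong (_+_ (f i)) (Σℕ≡sum (f ∘ punchIn i)) ⟨
  f i + Σℕ (f ∘ punchIn i)  ∎

Σℕ-*ˡ : ∀ {n} m (f : Fin n → ℕ) → Σℕ (λ k → m * f k) ≡ m * Σℕ f
Σℕ-*ˡ m f = begin
  Σℕ (λ k → m * f k)  ≡⟨ Σℕ≡sum (λ k → m * f k) ⟩
  sum (λ k → m * f k) ≡⟨ *-distribˡ-sum m f ⟨
  m * sum f           ≡⟨ cong (m *_) (Σℕ≡sum f) ⟨
  m * Σℕ f            ∎

Σℤ+Σℕ : ∀ {n} {f : Fin n → ℤ} {g h : Fin n → ℕ} →
        (∀ k → f k +ℤ + g k ≡ + h k) → Σℤ f +ℤ + Σℕ g ≡ + Σℕ h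
Σℤ+Σℕ {zero}  _ = refl
Σℤ+Σℕ {suc n} {f} {g} {h} pointwise = begin
  (f fz +ℤ Σℤ (f ∘ fs)) +ℤ (+ g fz +ℤ + Σℕ (g ∘ fs)) ≡⟨ interchange (f fz) _ (+ g fz) _ ⟩
  (f fz +ℤ + g fz) +ℤ (Σℤ (f ∘ fs) +ℤ + Σℕ (g ∘ fs)) ≡⟨ cong₂ _+ℤ_ (pointwise fz) (Σℤ+Σℕ (pointwise ∘ fs)) ⟩
  + h fz +ℤ + Σℕ (h ∘ fs)                           ∎

δ : ∀ {n} → Fin n → Fin n → ℕ
δ i j = if does (i ≟ j) then 1 else 0

δ-refl : ∀ {n} (i : Fin n) → δ i i ≡ 1
δ-refl i rewrite dec-true (i ≟ i) refl = refl

δ-≢ : ∀ {n} {i j : Fin n} → i ≢ j → δ i j ≡ 0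
δ-≢ {i = i} {j} i≢j rewrite dec-false (i ≟ j) i≢j = refl

δ-injective : ∀ {m n} {f : Fin m → Fin n} → (∀ {x y} → f x ≡ f y → x ≡ y) →
              ∀ i j → δ (f i) (f j) ≡ δ i j
δ-injective {f = f} f-injective i j with i ≟ j
... | yes refl = δ-refl (f i)
... | no  i≢j  = δ-≢ (i≢j ∘ f-injective)

Σℕ-δ : ∀ {n} (i : Fin n) (g : Fin n → ℕ) → Σℕ (λ k → δ k i * g k) ≡ g i
Σℕ-δ {suc n} i g = begin
  Σℕ (λ k → δ k i * g k)                                ≡⟨ Σℕ-remove i (λ k → δ k i * g k) ⟩
  δ i i * g i + Σℕ (λ k → δ (punchIn i k) i * g (punchIn i k))
    ≡⟨ cong₂ _+_ (cong (_* g i) (δ-refl i)) (Σℕ-zero others-vanish) ⟩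
  1 * g i + 0                                           ≡⟨ trans (+-identityʳ _) (*-identityˡ _) ⟩
  g i                                                   ∎
  where
  others-vanish : ∀ k → δ (punchIn i k) i * g (punchIn i k) ≡ 0
  others-vanish k = cong (_* g (punchIn i k)) (δ-≢ (punchInᵢ≢i i k))

[,]-injective : ∀ {A B C : Set} {f : A → C} {g : B → C} →
  (∀ {a a′} → f a ≡ f a′ → a ≡ a′) → (∀ {b b′} → g b ≡ g b′ → b ≡ b′) → (∀ a b → f a ≢ g b) →
  ∀ {x y} → [ f , g ]′ x ≡ [ f , g ]′ y → x ≡ y
[,]-injective f-inj g-inj f≢g {inj₁ a} {inj₁ a′} e = cong inj₁ (f-inj e)
[,]-injective f-inj g-inj f≢g {inj₁ a} {inj₂ b}  e = ⊥-elim (f≢g a b e)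
[,]-injective f-inj g-inj f≢g {inj₂ b} {inj₁ a}  e = ⊥-elim (f≢g a b (sym e))
[,]-injective f-inj g-inj f≢g {inj₂ b} {inj₂ b′} e = cong inj₂ (g-inj e)

injective⇒surjective : ∀ {n} {f : Fin n → Fin n} → (∀ {x y} → f x ≡ f y → x ≡ y) →
                       ∀ y → ∃ λ x → f x ≡ y
injective⇒surjective {n} {f} f-injective y with any? (λ x → f x ≟ y)
... | yes hit = hit
... | no  miss = ⊥-elim (<-irrefl refl (injective⇒≤ {f = y ∷ f} y∷f-injective))
  where
  y∷f-injective : ∀ {a b} → (y ∷ f) a ≡ (y ∷ f) b → a ≡ b
  y∷f-injective {fz}   {fz}   _ = refl
  y∷f-injective {fz}   {fs b} e = ⊥-elim (miss (b , sym e))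
  y∷f-injective {fs a} {fz}   e = ⊥-elim (miss (a , e))
  y∷f-injective {fs a} {fs b} e = cong fs (f-injective e)

isNone : Edge → ℕ
isNone none = 1
isNone pos  = 0
isNone neg  = 0

negativeProduct : Edge → Edge → ℕ
negativeProduct pos neg = 1
negativeProduct neg pos = 1
negativeProduct _   _   = 0

isEdge+isNone≡1 : ∀ e → isEdge e + isNone e ≡ 1
isEdge+isNone≡1 none = refl
isEdge+isNone≡1 pos  = refl
isEdge+isNone≡1 neg  = refl

isEdge≡isPos+isNeg : ∀ e → isEdge e ≡ isPos e + isNeg e
isEdge≡isPos+isNeg none = refl
isEdge≡isPos+isNeg pos  = refl
isEdge≡isPos+isNeg neg  = refl

isNone≡0 : ∀ {e} → e ≢ none → isNone e ≡ 0
isNone≡0 {none} e≢none = ⊥-elim (e≢none refl)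
isNone≡0 {pos}  _      = refl
isNone≡0 {neg}  _      = refl

isNeg≢0⇒neg : ∀ {e} → isNeg e ≢ 0 → e ≡ neg
isNeg≢0⇒neg {none} isNeg≢0 = ⊥-elim (isNeg≢0 refl)
isNeg≢0⇒neg {pos}  isNeg≢0 = ⊥-elim (isNeg≢0 refl)
isNeg≢0⇒neg {neg}  _       = refl

isNeg%2 : ∀ e → isNeg e % 2 ≡ isNeg e
isNeg%2 none = refl
isNeg%2 pos  = refl
isNeg%2 neg  = refl

isNone-isNeg-injective : ∀ {e f} → isNone e ≡ isNone f → isNeg e ≡ isNeg f → e ≡ f
isNone-isNeg-injective {none} {none} _ _ = refl
isNone-isNeg-injective {pos}  {pos}  _ _ = refl
isNone-isNeg-injective {neg}  {neg}  _ _ = refl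
isNone-isNeg-injective {none} {pos}  () _
isNone-isNeg-injective {none} {neg}  () _
isNone-isNeg-injective {pos}  {none} () _
isNone-isNeg-injective {neg}  {none} () _
isNone-isNeg-injective {pos}  {neg}  _ ()
isNone-isNeg-injective {neg}  {pos}  _ ()

path-sign-parity : ∀ e f →
  edgeValue e *ℤ edgeValue f +ℤ + (2 * negativeProduct e f) ≡ + (isEdge e * isEdge f)
path-sign-parity none none = refl
path-sign-parity none pos  = refl
path-sign-parity none neg  = refl
path-sign-parity pos  none = refl
path-sign-parity pos  pos  = refl
path-sign-parity pos  neg  = refl
path-sign-parity neg  none = refl
path-sign-parity neg  pos  = refl
path-sign-parity neg  neg  = refl

path-inclusion-exclusion : ∀ e f →
  isEdge e * isEdge f + 1 ≡ isEdge e + isEdge f + isNone e * isNone f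
path-inclusion-exclusion none none = refl
path-inclusion-exclusion none pos  = refl
path-inclusion-exclusion none neg  = refl
path-inclusion-exclusion pos  none = refl
path-inclusion-exclusion pos  pos  = refl
path-inclusion-exclusion pos  neg  = refl
path-inclusion-exclusion neg  none = refl
path-inclusion-exclusion neg  pos  = refl
path-inclusion-exclusion neg  neg  = refl

module _ {n} (G : SignedGraph n) where

  -- Every vertex counts as a non-neighbour of itself, since G is loopless.
  nonNeighbours : Fin n → ℕ
  nonNeighbours i = Σℕ (λ k → isNone (adj G i k))

  commonNeighbours commonNonNeighbours negativePaths : Fin n → Fin n → ℕ
  commonNeighbours    i j = Σℕ (λ k → isEdge (adj G i k) * isEdge (adj G k j))
  commonNonNeighbours i j = Σℕ (λ k → isNone (adj G i k) * isNone (adj G k j))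
  negativePaths       i j = Σℕ (λ k → negativeProduct (adj G i k) (adj G k j))

  degree+nonNeighbours≡n : ∀ i → degree G i + nonNeighbours i ≡ n
  degree+nonNeighbours≡n i = begin
    degree G i + nonNeighbours i                       ≡⟨ Σℕ-+ (isEdge ∘ adj G i) (isNone ∘ adj G i) ⟨
    Σℕ (λ k → isEdge (adj G i k) + isNone (adj G i k)) ≡⟨ Σℕ-cong (λ k → isEdge+isNone≡1 (adj G i k)) ⟩
    Σℕ {n} (λ _ → 1)                                   ≡⟨ Σℕ-ones ⟩
    n                                                  ∎

  degree≡posDegree+negDegree : ∀ i → degree G i ≡ posDegree G i + negDegree G i
  degree≡posDegree+negDegree i =
    trans (Σℕ-cong (λ k → isEdge≡isPos+isNeg (adj G i k))) (Σℕ-+ (isPos ∘ adj G i) (isNeg ∘ adj G i))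

  commonNeighbours+n : ∀ i j →
    commonNeighbours i j + n ≡ degree G i + degree G j + commonNonNeighbours i j
  commonNeighbours+n i j = begin
    commonNeighbours i j + n
      ≡⟨ cong (_+_ (commonNeighbours i j)) Σℕ-ones ⟨
    commonNeighbours i j + Σℕ {n} (λ _ → 1)
      ≡⟨ Σℕ-+ (λ k → isEdge (a i k) * isEdge (a k j)) (λ _ → 1) ⟨
    Σℕ (λ k → isEdge (a i k) * isEdge (a k j) + 1)
      ≡⟨ Σℕ-cong (λ k → path-inclusion-exclusion (a i k) (a k j)) ⟩
    Σℕ (λ k → isEdge (a i k) + isEdge (a k j) + isNone (a i k) * isNone (a k j))
      ≡⟨ Σℕ-+ (λ k → isEdge (a i k) + isEdge (a k j)) (λ k → isNone (a i k) * isNone (a k j)) ⟩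
    Σℕ (λ k → isEdge (a i k) + isEdge (a k j)) + commonNonNeighbours i j
      ≡⟨ cong (_+ commonNonNeighbours i j) (Σℕ-+ (isEdge ∘ a i) (λ k → isEdge (a k j))) ⟩
    degree G i + Σℕ (λ k → isEdge (a k j)) + commonNonNeighbours i j
      ≡⟨ cong (λ d → degree G i + d + commonNonNeighbours i j)
              (Σℕ-cong (λ k → cong isEdge (SignedGraph.sym G k j))) ⟩
    degree G i + degree G j + commonNonNeighbours i j
      ∎
    where a = adj G

  A²+2*negativePaths : ∀ i j → A² G i j +ℤ + (2 * negativePaths i j) ≡ + commonNeighbours i j
  A²+2*negativePaths i j = begin
    A² G i j +ℤ + (2 * negativePaths i j)
      ≡⟨ cong (λ m → A² G i j +ℤ + m) (Σℕ-*ˡ 2 (λ k → negativeProduct (adj G i k) (adj G k j))) ⟨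
    A² G i j +ℤ + Σℕ (λ k → 2 * negativeProduct (adj G i k) (adj G k j))
      ≡⟨ Σℤ+Σℕ (λ k → path-sign-parity (adj G i k) (adj G k j)) ⟩
    + commonNeighbours i j
      ∎

  ∃-negative-neighbour : ∀ i → negDegree G i ≢ 0 → ∃ λ k → adj G i k ≡ neg
  ∃-negative-neighbour i negDegree≢0 =
    let k , isNeg≢0 = Σℕ-nonzero negDegree≢0 in k , isNeg≢0⇒neg isNeg≢0

  NonNeighbourhood : Fin n → Fin n → Fin n → Set
  NonNeighbourhood x u v = ∀ k → isNone (adj G x k) ≡ δ k x + δ k u + δ k v

  commonNonNeighbours-of-NonNeighbourhood : ∀ {x u v} → NonNeighbourhood x u v → ∀ y →
    commonNonNeighbours x y ≡ isNone (adj G x y) + isNone (adj G u y) + isNone (adj G v y)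
  commonNonNeighbours-of-NonNeighbourhood {x} {u} {v} nbhd y = begin
    Σℕ (λ k → isNone (adj G x k) * g k)
      ≡⟨ Σℕ-cong (λ k → trans (cong (_* g k) (nbhd k)) (distrib (δ k x) (δ k u) (δ k v) (g k))) ⟩
    Σℕ (λ k → δ k x * g k + δ k u * g k + δ k v * g k)
      ≡⟨ Σℕ-+ (λ k → δ k x * g k + δ k u * g k) (λ k → δ k v * g k) ⟩
    Σℕ (λ k → δ k x * g k + δ k u * g k) + Σℕ (λ k → δ k v * g k)
      ≡⟨ cong (_+ Σℕ (λ k → δ k v * g k)) (Σℕ-+ (λ k → δ k x * g k) (λ k → δ k u * g k)) ⟩
    Σℕ (λ k → δ k x * g k) + Σℕ (λ k → δ k u * g k) + Σℕ (λ k → δ k v * g k)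
      ≡⟨ cong₂ _+_ (cong₂ _+_ (Σℕ-δ x g) (Σℕ-δ u g)) (Σℕ-δ v g) ⟩
    g x + g u + g v
      ∎
    where
    g : Fin n → ℕ
    g k = isNone (adj G k y)
    distrib : ∀ a b c d → (a + b + c) * d ≡ a * d + b * d + c * d
    distrib a b c d = trans (*-distribʳ-+ d (a + b) c) (cong (_+ c * d) (*-distribʳ-+ d a b))

record NoneEnumeration {n} (r : Fin n → Edge) (m : ℕ) : Set where
  field
    index      : Fin m → Fin n
    injective  : ∀ {j j′} → index j ≡ index j′ → j ≡ j′
    index-none : ∀ j → r (index j) ≡ none
    onto       : ∀ {k} → r k ≡ none → ∃ λ j → index j ≡ k

enumerateNones : ∀ {n} (r : Fin n → Edge) → NoneEnumeration r (Σℕ (λ k → isNone (r k)))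
enumerateNones {zero}  r = record
  { index = λ () ; injective = λ { {()} } ; index-none = λ () ; onto = λ { {()} } }
enumerateNones {suc n} r = prepend (r fz) refl (enumerateNones (r ∘ fs))
  where
  skip : ∀ {m} → r fz ≢ none → NoneEnumeration (r ∘ fs) m → NoneEnumeration r m
  skip r0≢none E = record
    { index = fs ∘ index ; injective = injective ∘ suc-injective ; index-none = index-none
    ; onto = λ { {fz} r0≡none → ⊥-elim (r0≢none r0≡none)
               ; {fs k} rk≡none → let j , e = onto rk≡none in j , cong fs e }
    }
    where open NoneEnumeration E

  prepend : ∀ {m} e → r fz ≡ e → NoneEnumeration (r ∘ fs) m → NoneEnumeration r (isNone e + m)
  prepend none r0≡none E = record
    { index = λ { fz → fz ; (fs j) → fs (index j) }
    ; injective = λ { {fz} {fz} _ → refl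
                    ; {fs j} {fs j′} e → cong fs (injective (suc-injective e)) }
    ; index-none = λ { fz → r0≡none ; (fs j) → index-none j }
    ; onto = λ { {fz} _ → fz , refl
               ; {fs k} rk≡none → let j , e = onto rk≡none in fs j , cong fs e }
    }
    where open NoneEnumeration E
  prepend pos r0≡pos E = skip (λ r0≡none → case trans (sym r0≡pos) r0≡none of λ ()) E
  prepend neg r0≡neg E = skip (λ r0≡none → case trans (sym r0≡neg) r0≡none of λ ()) E

record TwoRegularGraph (n : ℕ) : Set₁ where
  field
    _~_       : Fin n → Fin n → Set
    ~-sym     : ∀ {x y} → x ~ y → y ~ x
    ~-irrefl  : ∀ {x} → ¬ x ~ x
    nbr₁ nbr₂ : Fin n → Fin n
    nbr₁≢nbr₂ : ∀ x → nbr₁ x ≢ nbr₂ x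
    ~-nbr₁    : ∀ x → x ~ nbr₁ x
    ~-nbr₂    : ∀ x → x ~ nbr₂ x
    ~⇒nbr     : ∀ {x y} → x ~ y → y ≡ nbr₁ x ⊎ y ≡ nbr₂ x

  TriangleFree : Set
  TriangleFree = ∀ {x y z} → x ~ y → y ~ z → z ~ x → ⊥

  SquareFree : Set
  SquareFree = ∀ {x y z w} → x ~ y → y ~ z → z ~ w → w ~ x → x ≢ z → y ≢ w → ⊥

module TwoRegularGraphProperties {n} (H : TwoRegularGraph n) where

  open TwoRegularGraph H

  ~⇒≢ : ∀ {x y} → x ~ y → x ≢ y
  ~⇒≢ x~y refl = ~-irrefl x~y

  ~-between : ∀ {x u v k} → x ~ u → x ~ v → u ≢ v → x ~ k → k ≡ u ⊎ k ≡ v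
  ~-between x~u x~v u≢v x~k with ~⇒nbr x~u | ~⇒nbr x~v | ~⇒nbr x~k
  ... | inj₁ refl | inj₁ refl | _         = ⊥-elim (u≢v refl)
  ... | inj₂ refl | inj₂ refl | _         = ⊥-elim (u≢v refl)
  ... | inj₁ refl | inj₂ refl | inj₁ refl = inj₁ refl
  ... | inj₁ refl | inj₂ refl | inj₂ refl = inj₂ refl
  ... | inj₂ refl | inj₁ refl | inj₁ refl = inj₂ refl
  ... | inj₂ refl | inj₁ refl | inj₂ refl = inj₁ refl

  other : Fin n → Fin n → Fin n
  other x y with nbr₁ x ≟ y
  ... | yes _ = nbr₂ x
  ... | no  _ = nbr₁ x

  ~-other : ∀ x y → x ~ other x y
  ~-other x y with nbr₁ x ≟ y
  ... | yes _ = ~-nbr₂ x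
  ... | no  _ = ~-nbr₁ x

  other-≢ : ∀ x y → other x y ≢ y
  other-≢ x y with nbr₁ x ≟ y
  ... | yes refl = nbr₁≢nbr₂ x ∘ sym
  ... | no  nbr₁≢y = nbr₁≢y

  walk : Fin n → ℕ → Fin n
  walk v zero          = v
  walk v (suc zero)    = nbr₁ v
  walk v (suc (suc t)) = other (walk v (suc t)) (walk v t)

  walk-~ : ∀ v t → walk v t ~ walk v (suc t)
  walk-~ v zero    = ~-nbr₁ v
  walk-~ v (suc t) = ~-other (walk v (suc t)) (walk v t)

  walk-≢ : ∀ v t → walk v (suc (suc t)) ≢ walk v t
  walk-≢ v t = other-≢ (walk v (suc t)) (walk v t)

  walk-nbr : ∀ v t {k} → walk v (suc t) ~ k → k ≡ walk v t ⊎ k ≡ walk v (suc (suc t))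
  walk-nbr v t = ~-between (~-sym (walk-~ v t)) (walk-~ v (suc t)) (walk-≢ v t ∘ sym)

  Distinct : Fin n → ℕ → Set
  Distinct v t = ∀ {i j} → i < j → j < t → walk v i ≢ walk v j

  prefix : Fin n → (t : ℕ) → Fin t → Fin n
  prefix v t j = walk v (toℕ j)

  Distinct⇒prefix-injective : ∀ {v t} → Distinct v t → ∀ {j j′} → prefix v t j ≡ prefix v t j′ → j ≡ j′
  Distinct⇒prefix-injective D {j} {j′} e with <-cmp (toℕ j) (toℕ j′)
  ... | tri< j<j′ _ _ = ⊥-elim (D j<j′ (toℕ<n j′) e)
  ... | tri≈ _ j≡j′ _ = toℕ-injective j≡j′
  ... | tri> _ _ j′<j = ⊥-elim (D j′<j (toℕ<n j) (sym e))

  -- A walk that first repeats a vertex can only return to its start: any other repeated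
  -- vertex would acquire a third neighbour on the walk.
  walk-revisit : ∀ {v t i} → Distinct v (suc t) → i < t → walk v (suc i) ≢ walk v (suc t)
  walk-revisit {v} {t} {i} D i<t e
    with walk-nbr v i (subst (_~ walk v t) (sym e) (~-sym (walk-~ v t)))
  ... | inj₁ wt≡wi = D i<t (n<1+n t) (sym wt≡wi)
  ... | inj₂ wt≡w2+i with <-cmp (suc (suc i)) t
  ...   | tri< 2+i<t _ _ = D 2+i<t (n<1+n t) (sym wt≡w2+i)
  ...   | tri≈ _ refl _  = walk-≢ v (suc i) (sym e)
  ...   | tri> _ _ t<2+i with ≤-antisym (s≤s⁻¹ t<2+i) i<t
  ...     | refl = ~⇒≢ (walk-~ v (suc i)) e

  Distinct-suc : ∀ {v t} → Distinct v t → walk v t ≢ v → Distinct v (suc t)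
  Distinct-suc D wt≢v {i} i<j j<1+t with m≤n⇒m<n∨m≡n (s≤s⁻¹ j<1+t)
  ... | inj₁ j<t = D i<j j<t
  Distinct-suc D wt≢v {zero}  i<j _ | inj₂ refl = wt≢v ∘ sym
  Distinct-suc {t = suc t} D wt≢v {suc i} i<j _ | inj₂ refl = walk-revisit D (s≤s⁻¹ i<j)

  Distinct-1 : ∀ {v} → Distinct v 1
  Distinct-1 {i = i} i<j (s≤s z≤n) = ⊥-elim (<⇒≱ i<j z≤n)

  Distinct-5 : TriangleFree → SquareFree → ∀ v → Distinct v 5
  Distinct-5 triangleFree squareFree v = D₅
    where
    w = walk v
    D₂ = Distinct-suc Distinct-1 (~⇒≢ (walk-~ v 0) ∘ sym)
    D₃ = Distinct-suc D₂ (walk-≢ v 0)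
    D₄ = Distinct-suc D₃ λ w₃≡w₀ →
      triangleFree (walk-~ v 0) (walk-~ v 1) (subst (w 2 ~_) w₃≡w₀ (walk-~ v 2))
    D₅ = Distinct-suc D₄ λ w₄≡w₀ →
      squareFree (walk-~ v 0) (walk-~ v 1) (walk-~ v 2) (subst (w 3 ~_) w₄≡w₀ (walk-~ v 3))
                 (D₄ (s≤s z≤n) (s≤s (s≤s (s≤s z≤n))))
                 (D₄ (s≤s (s≤s z≤n)) (s≤s (s≤s (s≤s (s≤s z≤n)))))

  OnWalk : Fin n → (t : ℕ) → Fin n → Set
  OnWalk v t y = ∃ λ (j : Fin t) → prefix v t j ≡ y

  onWalk : ∀ {v t j} → j < t → OnWalk v t (walk v j)
  onWalk {v} j<t = fromℕ< j<t , cong (walk v) (toℕ-fromℕ< j<t)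

  closed-walk-neighbour : ∀ {v t} → Distinct v (3 + t) → walk v (3 + t) ≡ v →
                       ∀ {i y} → i < 3 + t → walk v i ~ y → OnWalk v (3 + t) y
  closed-walk-neighbour {v} {t} D return {zero} _ v~y
    with ~-between (walk-~ v 0) (~-sym (subst (walk v (2 + t) ~_) return (walk-~ v (2 + t))))
                   (D (s≤s (s≤s z≤n)) (n<1+n (2 + t))) v~y
  ... | inj₁ refl = onWalk (s≤s (s≤s z≤n))
  ... | inj₂ refl = onWalk (n<1+n (2 + t))
  closed-walk-neighbour {v} {t} D return {suc i} 1+i<3+t wi~y with walk-nbr v i wi~y
  ... | inj₁ refl = onWalk (<-trans (n<1+n i) 1+i<3+t)
  ... | inj₂ refl with m≤n⇒m<n∨m≡n 1+i<3+t
  ...   | inj₁ 2+i<3+t = onWalk 2+i<3+t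
  ...   | inj₂ 2+i≡3+t = subst (OnWalk v (3 + t)) (trans (sym return) (cong (walk v) (sym 2+i≡3+t)))
                               (onWalk (s≤s z≤n))

  OnWalk? : ∀ v t y → Dec (OnWalk v t y)
  OnWalk? v t y = any? (λ j → prefix v t j ≟ y)

  ∃-off-walk : ∀ {v t} → t < n → ∃ λ u → ¬ OnWalk v t u
  ∃-off-walk {v} {t} t<n = ¬∀⟶∃¬ n (OnWalk v t) (OnWalk? v t) λ onWalk →
    <⇒≱ t<n (injective⇒≤ {f = proj₁ ∘ onWalk} λ {y} {y′} e →
      trans (sym (proj₂ (onWalk y))) (trans (cong (prefix v t) e) (proj₂ (onWalk y′))))

  walk-avoids : ∀ {v t u} → (∀ {i y} → i < t → walk v i ~ y → OnWalk v t y) →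
                ¬ OnWalk v t u → ∀ k → ¬ OnWalk v t (walk u k)
  walk-avoids closed u∉ zero = u∉
  walk-avoids {u = u} closed u∉ (suc k) (j , e) =
    walk-avoids closed u∉ k (closed (toℕ<n j) (subst (_~ walk u k) (sym e) (~-sym (walk-~ u k))))

  -- The closed walk through v and the first five vertices of a walk starting off it are
  -- t + 5 distinct vertices.
  closed-walk+5≤n : (∀ u → Distinct u 5) → ∀ {v t} → 3 ≤ t → Distinct v t → walk v t ≡ v →
                    t < n → t + 5 ≤ n
  closed-walk+5≤n distinct5 {v} {T@(suc (suc (suc _)))} (s≤s (s≤s (s≤s _))) D return T<n =
    injective⇒≤ {f = f} f-injective
    where
    u = proj₁ (∃-off-walk T<n)
    avoids : ∀ j k → prefix v T j ≢ prefix u 5 k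
    avoids j k e = walk-avoids (closed-walk-neighbour D return) (proj₂ (∃-off-walk T<n)) (toℕ k) (j , e)
    f : Fin (T + 5) → Fin n
    f = [ prefix v T , prefix u 5 ]′ ∘ splitAt T
    f-injective : ∀ {a b} → f a ≡ f b → a ≡ b
    f-injective {a} {b} e = begin
      a                         ≡⟨ join-splitAt T 5 a ⟨
      join T 5 (splitAt T a)    ≡⟨ cong (join T 5) ([,]-injective (Distinct⇒prefix-injective D)
                                     (Distinct⇒prefix-injective (distinct5 u)) avoids
                                     {splitAt T a} {splitAt T b} e) ⟩
      join T 5 (splitAt T b)    ≡⟨ join-splitAt T 5 b ⟩
      b                         ∎

  hamiltonian : n < 10 → TriangleFree → SquareFree → ∀ v → Distinct v n × walk v n ≡ v
  hamiltonian n<10 triangleFree squareFree v = distinct n ≤-refl , closes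
    where
    distinct5 = Distinct-5 triangleFree squareFree

    no-early-return : ∀ {t} → 0 < t → t < n → Distinct v t → walk v t ≢ v
    no-early-return {t} 0<t t<n D wt≡v with t <? 5
    ... | yes t<5 = distinct5 v 0<t t<5 (sym wt≡v)
    ... | no  t≮5 = <⇒≱ n<10 (≤-trans (+-monoˡ-≤ 5 5≤t) (closed-walk+5≤n distinct5 3≤t D wt≡v t<n))
      where
      5≤t = ≮⇒≥ t≮5
      3≤t = ≤-trans (s≤s (s≤s (s≤s z≤n))) 5≤t

    distinct : ∀ t → t ≤ n → Distinct v t
    distinct zero                _     _ ()
    distinct (suc zero)          _     = Distinct-1
    distinct (suc (suc t)) 2+t≤n =
      let D = distinct (suc t) (<⇒≤ 2+t≤n) in Distinct-suc D (no-early-return (s≤s z≤n) 2+t≤n D)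

    closes : walk v n ≡ v
    closes with walk v n ≟ v
    ... | yes wn≡v = wn≡v
    ... | no  wn≢v = ⊥-elim (<-irrefl refl (injective⇒≤
                       (Distinct⇒prefix-injective (Distinct-suc (distinct n ≤-refl) wn≢v))))

next prev : Fin 9 → Fin 9
next x = suc (toℕ x) mod 9
prev x = (toℕ x + 8) mod 9

next-prev : ∀ x → next (prev x) ≡ x
next-prev = toWitness {a? = all? λ x → next (prev x) ≟ x} _

prev≢next : ∀ x → prev x ≢ next x
prev≢next = toWitness {a? = all? λ x → ¬? (prev x ≟ next x)} _

S¹₉-nonNeighbourhood : ∀ x → NonNeighbourhood S¹₉ x (prev x) (next x)
S¹₉-nonNeighbourhood = toWitness {a? = all? λ x → all? λ k →
  isNone (s9adj x k) ≟ℕ δ k x + δ k (prev x) + δ k (next x)} _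

S¹₉-parity : ∀ x y → x ≢ y → commonNonNeighbours S¹₉ x y % 2 ≡ isNeg (s9adj x y)
S¹₉-parity = toWitness {a? = all? λ x → all? λ y →
  ¬? (x ≟ y) →-dec commonNonNeighbours S¹₉ x y % 2 ≟ℕ isNeg (s9adj x y)} _

module Characterisation {G : SignedGraph 9} (regular : Regular G 6) (netRegular : NetRegular G (+ 2))
  (A²-pos  : ∀ i j → adj G i j ≡ pos → A² G i j ≡ - (+ 1))
  (A²-neg  : ∀ i j → adj G i j ≡ neg → A² G i j ≡ + 0)
  (A²-none : ∀ i j → i ≢ j → adj G i j ≡ none → A² G i j ≡ + 1) where

  A²+1 : ∀ {i j} → i ≢ j → A² G i j +ℤ + 1 ≡ + (isNeg (adj G i j) + isNone (adj G i j) * 2)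
  A²+1 {i} {j} i≢j with adj G i j in e
  ... | pos  rewrite A²-pos i j e       = refl
  ... | neg  rewrite A²-neg i j e       = refl
  ... | none rewrite A²-none i j i≢j e = refl

  commonNeighbours+1 : ∀ {i j} → i ≢ j →
    commonNeighbours G i j + 1 ≡ isNeg (adj G i j) + (isNone (adj G i j) + negativePaths G i j) * 2
  commonNeighbours+1 {i} {j} i≢j = ℤ.+-injective (begin
    + commonNeighbours G i j +ℤ + 1                 ≡⟨ cong (_+ℤ + 1) (A²+2*negativePaths G i j) ⟨
    A² G i j +ℤ + (2 * N) +ℤ + 1                    ≡⟨ xy∙z≈xz∙y (A² G i j) _ _ ⟩
    A² G i j +ℤ + 1 +ℤ + (2 * N)                    ≡⟨ cong (_+ℤ + (2 * N)) (A²+1 i≢j) ⟩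
    + (isNeg e + isNone e * 2 + 2 * N)               ≡⟨ cong +_ (begin
      isNeg e + isNone e * 2 + 2 * N                   ≡⟨ +-assoc (isNeg e) _ _ ⟩
      isNeg e + (isNone e * 2 + 2 * N)                 ≡⟨ cong (λ m → isNeg e + (isNone e * 2 + m)) (*-comm 2 N) ⟩
      isNeg e + (isNone e * 2 + N * 2)                 ≡⟨ cong (_+_ (isNeg e)) (*-distribʳ-+ 2 (isNone e) N) ⟨
      isNeg e + (isNone e + N) * 2                     ∎) ⟩
    + (isNeg e + (isNone e + N) * 2)                 ∎)
    where
    e = adj G i j
    N = negativePaths G i j

  commonNonNeighbours+4 : ∀ i j → commonNonNeighbours G i j + 2 * 2 ≡ commonNeighbours G i j + 1
  commonNonNeighbours+4 i j = +-cancelʳ-≡ 8 _ _ (begin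
    Z + 4 + 8                                 ≡⟨ trans (+-assoc Z 4 8) (+-comm Z 12) ⟩
    6 + 6 + Z                                 ≡⟨ cong₂ (λ d d′ → d + d′ + Z) (regular i) (regular j) ⟨
    degree G i + degree G j + Z               ≡⟨ commonNeighbours+n G i j ⟨
    commonNeighbours G i j + 9                ≡⟨ +-assoc (commonNeighbours G i j) 1 8 ⟨
    commonNeighbours G i j + 1 + 8            ∎)
    where Z = commonNonNeighbours G i j

  commonNonNeighbours-parity : ∀ {i j} → i ≢ j → commonNonNeighbours G i j % 2 ≡ isNeg (adj G i j)
  commonNonNeighbours-parity {i} {j} i≢j = begin
    Z % 2                          ≡⟨ [m+kn]%n≡m%n Z 2 2 ⟨
    (Z + 2 * 2) % 2                ≡⟨ cong (_% 2) (trans (commonNonNeighbours+4 i j) (commonNeighbours+1 i≢j)) ⟩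
    (isNeg e + (isNone e + N) * 2) % 2 ≡⟨ [m+kn]%n≡m%n (isNeg e) (isNone e + N) 2 ⟩
    isNeg e % 2                    ≡⟨ isNeg%2 e ⟩
    isNeg e                        ∎
    where
    Z = commonNonNeighbours G i j
    N = negativePaths G i j
    e = adj G i j

  _~_ : Fin 9 → Fin 9 → Set
  x ~ y = x ≢ y × adj G x y ≡ none

  ~-sym : ∀ {x y} → x ~ y → y ~ x
  ~-sym {x} {y} (x≢y , xy≡none) = x≢y ∘ sym , trans (SignedGraph.sym G y x) xy≡none

  nonNeighbours≡3 : ∀ x → nonNeighbours G x ≡ 3
  nonNeighbours≡3 x = +-cancelˡ-≡ 6 (nonNeighbours G x) 3
    (trans (cong (_+ nonNeighbours G x) (sym (regular x))) (degree+nonNeighbours≡n G x))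

  -- Opaque so that using the transported enumeration below does not unfold this proof,
  -- which makes type checking very slow.
  opaque
    otherNonNeighbours≡2 : ∀ x → Σℕ (isNone ∘ adj G x ∘ punchIn x) ≡ 2
    otherNonNeighbours≡2 x = ℕ.suc-injective (begin
      1 + others                  ≡⟨ cong (λ e → isNone e + others) (loopless G x) ⟨
      isNone (adj G x x) + others ≡⟨ Σℕ-remove x (isNone ∘ adj G x) ⟨
      nonNeighbours G x           ≡⟨ nonNeighbours≡3 x ⟩
      3                           ∎)
      where
      others : ℕ
      others = Σℕ (isNone ∘ adj G x ∘ punchIn x)

  otherNonNeighbours : ∀ x → NoneEnumeration (adj G x ∘ punchIn x) 2
  otherNonNeighbours x =
    subst (NoneEnumeration (adj G x ∘ punchIn x)) (otherNonNeighbours≡2 x)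
          (enumerateNones (adj G x ∘ punchIn x))

  nonAdjacency : TwoRegularGraph 9
  nonAdjacency = record
    { _~_       = _~_
    ; ~-sym     = ~-sym
    ; ~-irrefl  = λ (x≢x , _) → x≢x refl
    ; nbr₁      = nbr fz
    ; nbr₂      = nbr (fs fz)
    ; nbr₁≢nbr₂ = nbr₁≢nbr₂
    ; ~-nbr₁    = ~-nbr fz
    ; ~-nbr₂    = ~-nbr (fs fz)
    ; ~⇒nbr     = ~⇒nbr
    }
    where
    open NoneEnumeration
    nbr : Fin 2 → Fin 9 → Fin 9
    nbr j x = punchIn x (index (otherNonNeighbours x) j)
    nbr₁≢nbr₂ : ∀ x → nbr fz x ≢ nbr (fs fz) x
    nbr₁≢nbr₂ x e with injective (otherNonNeighbours x) (punchIn-injective x _ _ e)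
    ... | ()
    ~-nbr : ∀ j x → x ~ nbr j x
    ~-nbr j x = punchInᵢ≢i x (index (otherNonNeighbours x) j) ∘ sym , index-none (otherNonNeighbours x) j
    ~⇒nbr : ∀ {x y} → x ~ y → y ≡ nbr fz x ⊎ y ≡ nbr (fs fz) x
    ~⇒nbr {x} {y} (x≢y , xy≡none) with onto (otherNonNeighbours x)
                                         (subst (λ k → adj G x k ≡ none) (sym (punchIn-punchOut x≢y)) xy≡none)
    ... | fz    , e = inj₁ (trans (sym (punchIn-punchOut x≢y)) (cong (punchIn x) (sym e)))
    ... | fs fz , e = inj₂ (trans (sym (punchIn-punchOut x≢y)) (cong (punchIn x) (sym e)))

  open TwoRegularGraph nonAdjacency using (TriangleFree; SquareFree)
  open TwoRegularGraphProperties nonAdjacency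

  nonNeighbourhood : ∀ {x u v} → x ~ u → x ~ v → u ≢ v → NonNeighbourhood G x u v
  nonNeighbourhood {x} {u} {v} x~u x~v u≢v k with k ≟ x | k ≟ u | k ≟ v
  ... | yes refl | yes refl | _        = ⊥-elim (proj₁ x~u refl)
  ... | yes refl | no _     | yes refl = ⊥-elim (proj₁ x~v refl)
  ... | yes refl | no _     | no _     = cong isNone (loopless G x)
  ... | no _     | yes refl | yes refl = ⊥-elim (u≢v refl)
  ... | no _     | yes refl | no _     = cong isNone (proj₂ x~u)
  ... | no _     | no _     | yes refl = cong isNone (proj₂ x~v)
  ... | no k≢x   | no k≢u   | no k≢v   = isNone≡0 λ xk≡none →
    [ k≢u , k≢v ]′ (~-between x~u x~v u≢v (k≢x ∘ sym , xk≡none))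

  nonNeighbourhood-parity : ∀ {x u v y} → NonNeighbourhood G x u v → x ≢ y →
    (isNone (adj G x y) + isNone (adj G u y) + isNone (adj G v y)) % 2 ≡ isNeg (adj G x y)
  nonNeighbourhood-parity {y = y} nbhd x≢y =
    trans (cong (_% 2) (sym (commonNonNeighbours-of-NonNeighbourhood G nbhd y)))
          (commonNonNeighbours-parity x≢y)

  ~⇒isNone≡1 : ∀ {x y} → x ~ y → isNone (adj G x y) ≡ 1
  ~⇒isNone≡1 (_ , xy≡none) = cong isNone xy≡none

  triangleFree : TriangleFree
  triangleFree {x} {y} {z} x~y y~z z~x = case 1≡0 of λ ()
    where
    1≡0 : (1 + 1 + 1) % 2 ≡ 0
    1≡0 = begin
      (1 + 1 + 1) % 2
        ≡⟨ cong (_% 2) (cong₂ _+_ (cong₂ _+_ (~⇒isNone≡1 x~y) (cong isNone (loopless G y)))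
                                  (~⇒isNone≡1 (~-sym y~z))) ⟨
      (isNone (adj G x y) + isNone (adj G y y) + isNone (adj G z y)) % 2
        ≡⟨ nonNeighbourhood-parity (nonNeighbourhood x~y (~-sym z~x) (proj₁ y~z)) (proj₁ x~y) ⟩
      isNeg (adj G x y)
        ≡⟨ cong isNeg (proj₂ x~y) ⟩
      0 ∎

  negDegree≢0 : ∀ x → negDegree G x ≢ 0
  negDegree≢0 x neg≡0 =
    case trans (cong₂ (λ p q → + p - + q) (sym pos≡6) (sym neg≡0)) (netRegular x) of λ ()
    where
    pos≡6 : posDegree G x ≡ 6
    pos≡6 = begin
      posDegree G x                  ≡⟨ +-identityʳ _ ⟨
      posDegree G x + 0              ≡⟨ cong (_+_ (posDegree G x)) neg≡0 ⟨
      posDegree G x + negDegree G x  ≡⟨ degree≡posDegree+negDegree G x ⟨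
      degree G x                     ≡⟨ regular x ⟩
      6                              ∎

  -- The closed non-neighbourhoods of x and of a negative neighbour m of x meet in an odd
  -- number of vertices; for x on a square xyzw this number is 2 (if m = z) or 0.
  square-with-negative-edge : ∀ {x y z w m} → x ~ y → y ~ z → z ~ w → w ~ x → x ≢ z → y ≢ w →
                              adj G x m ≡ neg → ⊥
  square-with-negative-edge {x} {y} {z} {w} {m} x~y y~z z~w w~x x≢z y≢w xm≡neg = case m ≟ z of λ
    { (yes refl) → case overlap-parity (~⇒isNone≡1 y~z) (~⇒isNone≡1 (~-sym z~w)) of λ ()
    ; (no  m≢z)  → case overlap-parity (off-z (~-sym x~y) y~z m≢z) (off-z w~x (~-sym z~w) m≢z) of λ ()
    }
    where
    x≢m : x ≢ m
    x≢m refl = case trans (sym (loopless G x)) xm≡neg of λ ()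
    overlap-parity : ∀ {a b} → isNone (adj G y m) ≡ a → isNone (adj G w m) ≡ b → (0 + a + b) % 2 ≡ 1
    overlap-parity {a} {b} ym wm = begin
      (0 + a + b) % 2
        ≡⟨ cong (_% 2) (cong₂ _+_ (cong₂ _+_ (cong isNone xm≡neg) ym) wm) ⟨
      (isNone (adj G x m) + isNone (adj G y m) + isNone (adj G w m)) % 2
        ≡⟨ nonNeighbourhood-parity (nonNeighbourhood x~y (~-sym w~x) y≢w) x≢m ⟩
      isNeg (adj G x m)
        ≡⟨ cong isNeg xm≡neg ⟩
      1 ∎
    off-z : ∀ {u} → u ~ x → u ~ z → m ≢ z → isNone (adj G u m) ≡ 0
    off-z {u} u~x u~z m≢z = isNone≡0 λ um≡none →
      [ x≢m ∘ sym , m≢z ]′ (~-between u~x u~z x≢z (u≢m , um≡none))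
      where
      u≢m : u ≢ m
      u≢m refl = case trans (sym xm≡neg) (proj₂ (~-sym u~x)) of λ ()

  squareFree : SquareFree
  squareFree x~y y~z z~w w~x x≢z y≢w =
    square-with-negative-edge x~y y~z z~w w~x x≢z y≢w (proj₂ (∃-negative-neighbour G _ (negDegree≢0 _)))

  hamiltonian-cycle : Distinct fz 9 × walk fz 9 ≡ fz
  hamiltonian-cycle = hamiltonian (n<1+n 9) triangleFree squareFree fz

  cycle : Fin 9 → Fin 9
  cycle = prefix fz 9

  cycle-injective : ∀ {x y} → cycle x ≡ cycle y → x ≡ y
  cycle-injective = Distinct⇒prefix-injective (proj₁ hamiltonian-cycle)

  cycle-next : ∀ x → cycle x ~ cycle (next x)
  cycle-next x with m≤n⇒m<n∨m≡n (toℕ<n x)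
  ... | inj₁ 1+x<9 = subst (λ t → cycle x ~ walk fz t)
                           (sym (trans (toℕ-fromℕ< _) (m≤n⇒m%n≡m (s≤s⁻¹ 1+x<9))))
                           (walk-~ fz (toℕ x))
  ... | inj₂ 1+x≡9 = subst (λ t → cycle x ~ walk fz t)
                           (sym (trans (toℕ-fromℕ< _) (cong (_% 9) 1+x≡9)))
                           (subst (cycle x ~_) (trans (cong (walk fz) 1+x≡9) (proj₂ hamiltonian-cycle))
                                  (walk-~ fz (toℕ x)))

  cycle-prev : ∀ x → cycle x ~ cycle (prev x)
  cycle-prev x = ~-sym (subst (λ y → cycle (prev x) ~ cycle y) (next-prev x) (cycle-next (prev x)))

  cycle-nonNeighbourhood : ∀ x → NonNeighbourhood G (cycle x) (cycle (prev x)) (cycle (next x))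
  cycle-nonNeighbourhood x = nonNeighbourhood (cycle-prev x) (cycle-next x) (prev≢next x ∘ cycle-injective)

  isNone-cycle : ∀ x y → isNone (adj G (cycle x) (cycle y)) ≡ isNone (s9adj x y)
  isNone-cycle x y = begin
    isNone (adj G (cycle x) (cycle y))
      ≡⟨ cycle-nonNeighbourhood x (cycle y) ⟩
    δ (cycle y) (cycle x) + δ (cycle y) (cycle (prev x)) + δ (cycle y) (cycle (next x))
      ≡⟨ cong₂ _+_ (cong₂ _+_ (δ-cycle x) (δ-cycle (prev x))) (δ-cycle (next x)) ⟩
    δ y x + δ y (prev x) + δ y (next x)
      ≡⟨ S¹₉-nonNeighbourhood x y ⟨
    isNone (s9adj x y)
      ∎
    where
    δ-cycle : ∀ z → δ (cycle y) (cycle z) ≡ δ y z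
    δ-cycle = δ-injective cycle-injective y

  commonNonNeighbours-cycle : ∀ x y →
    commonNonNeighbours G (cycle x) (cycle y) ≡ commonNonNeighbours S¹₉ x y
  commonNonNeighbours-cycle x y = begin
    commonNonNeighbours G (cycle x) (cycle y)
      ≡⟨ commonNonNeighbours-of-NonNeighbourhood G (cycle-nonNeighbourhood x) (cycle y) ⟩
    isNone (adj G (cycle x) (cycle y)) + isNone (adj G (cycle (prev x)) (cycle y))
      + isNone (adj G (cycle (next x)) (cycle y))
      ≡⟨ cong₂ _+_ (cong₂ _+_ (isNone-cycle x y) (isNone-cycle (prev x) y)) (isNone-cycle (next x) y) ⟩
    isNone (s9adj x y) + isNone (s9adj (prev x) y) + isNone (s9adj (next x) y)
      ≡⟨ commonNonNeighbours-of-NonNeighbourhood S¹₉ (S¹₉-nonNeighbourhood x) y ⟨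
    commonNonNeighbours S¹₉ x y
      ∎

  adj-cycle : ∀ x y → adj G (cycle x) (cycle y) ≡ s9adj x y
  adj-cycle x y with x ≟ y
  ... | yes refl = trans (loopless G (cycle x)) (sym (s9loop x))
  ... | no  x≢y  = isNone-isNeg-injective (isNone-cycle x y) (begin
    isNeg (adj G (cycle x) (cycle y))             ≡⟨ commonNonNeighbours-parity (x≢y ∘ cycle-injective) ⟨
    commonNonNeighbours G (cycle x) (cycle y) % 2 ≡⟨ cong (_% 2) (commonNonNeighbours-cycle x y) ⟩
    commonNonNeighbours S¹₉ x y % 2               ≡⟨ S¹₉-parity x y x≢y ⟩
    isNeg (s9adj x y)                             ∎)

  G≅S¹₉ : G ≅ S¹₉
  G≅S¹₉ = mk↔ₛ′ cycle⁻¹ cycle (λ x → cycle-injective (cycle-cycle⁻¹ (cycle x))) cycle-cycle⁻¹ ,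
          λ i j → begin
            s9adj (cycle⁻¹ i) (cycle⁻¹ j)
              ≡⟨ adj-cycle (cycle⁻¹ i) (cycle⁻¹ j) ⟨
            adj G (cycle (cycle⁻¹ i)) (cycle (cycle⁻¹ j))
              ≡⟨ cong₂ (adj G) (cycle-cycle⁻¹ i) (cycle-cycle⁻¹ j) ⟩
            adj G i j
              ∎
    where
    cycle⁻¹ : Fin 9 → Fin 9
    cycle⁻¹ y = proj₁ (injective⇒surjective cycle-injective y)
    cycle-cycle⁻¹ : ∀ y → cycle (cycle⁻¹ y) ≡ y
    cycle-cycle⁻¹ y = proj₂ (injective⇒surjective cycle-injective y)

lemma3p12 : (G : SignedGraph 9) →
    (InC1 G (- (+ 1)) (+ 0) (+ 1) ⊎ InC4 G (- (+ 1)) (+ 0) (+ 1) ⊎ InC5 G (- (+ 1)) (+ 0) (+ 1)) →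
    Connected G → ¬ Complete G → Regular G 6 → NetRegular G (+ 2) →
    IsSRSG G 6 (- (+ 1)) (+ 0) (+ 1) →
    G ≅ S¹₉
lemma3p12 G _ _ _ regular netRegular (_ , _ , _ , A²-pos , A²-neg , A²-none) =
  Characterisation.G≅S¹₉ {G} regular netRegular A²-pos A²-neg A²-none
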